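{- Let $\mathbf{C}$ be a category. Then $\mathbf{C}$ is a Kleene–Kozen category if and only if both of the following hold: (a) $\mathbf{C}$ is enriched over bounded join-semilattices and strict join-preserving maps; (b) there is a family of operators $(-)^{*}\colon \mathbf{C}(X,X)\to\mathbf{C}(X,X)$, $X$ ranging over the objects of $\mathbf{C}$, such that for all objects $X,Y$ and all morphisms $f,g,h$ of the indicated types: 1. $f^{*} = \mathrm{id}\vee f^{*}\circ f$ for all $f\colon X\to X$; 2. $\mathrm{id}^{*}=\mathrm{id}$; 3. $f^{*} = (f\vee \mathrm{id})^{*}$ for all $f\colon X\to X$; 4. for $h\colon Y\to Y$, $f\colon X\to Y$, $g\colon X\to X$: if $h\circ f = f\circ g$ then $h^{*}\circ f = f\circ g^{*}$.
   Context: A category $\mathbf{C}$ is enriched over bounded join-semilattices and strict join-preserving maps if every hom-set $\mathbf{C}(X,Y)$ is a join-semilattice $(\vee)$ with a least element $\bot$, and composition preserves binary joins and $\bot$ in each argument: $(f\vee g)\circ h=f\circ h\vee g\circ h$, $h\circ(f\vee g)=h\circ f\vee h\circ g$, $\bot\circ h=\bot$, $h\circ\bot=\bot$. The order is $f\le g$ iff $f\vee g=g$. A Kleene–Kozen category is a category $\mathbf{C}$ enriched in this way together with a Kleene iteration operator $(-)^{*}\colon\mathbf{C}(X,X)\to\mathbf{C}(X,X)$ such that, for all $f\colon Y\to Y$, $g\colon Y\to Z$, $h\colon X\to Y$, the morphism $g\circ f^{*}$ is the least (pre-)fixpoint of the map $x\mapsto g\vee x\circ f$ on $\mathbf{C}(Y,Z)$,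 and $f^{*}\circ h$ is the least (pre-)fixpoint of the map $x\mapsto h\vee f\circ x$ on $\mathbf{C}(X,Y)$. -}

module Defs where

open import Level using (Level; _⊔_) renaming (suc to lsuc)
open import Relation.Binary.PropositionalEquality using (_≡_)
open import Algebra.Structures using (IsIdempotentCommutativeMonoid)
open import Data.Product using (Σ; Σ-syntax)

record Category (o ℓ : Level) : Set (lsuc (o ⊔ ℓ)) where
  infixr 9 _∘_
  field
    Obj : Set o
    Hom : Obj → Obj → Set ℓ
    id  : ∀ {X} → Hom X X
    _∘_ : ∀ {X Y Z} → Hom Y Z → Hom X Y → Hom X Z
    identityˡ : ∀ {X Y} (f : Hom X Y) → id ∘ f ≡ f
    identityʳ : ∀ {X Y} (f : Hom X Y) → f ∘ id ≡ f
    assoc : ∀ {W X Y Z} (f : Hom Y Z) (g : Hom X Y) (h : Hom W X) →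
            (f ∘ g) ∘ h ≡ f ∘ (g ∘ h)

-- Enrichment over bounded join-semilattices and strict join-preserving maps.
-- A bounded join-semilattice (∨, ⊥) is an idempotent commutative monoid.
record JSLEnrichment {o ℓ} (C : Category o ℓ) : Set (o ⊔ ℓ) where
  open Category C
  infixr 6 _∨_
  field
    _∨_ : ∀ {X Y} → Hom X Y → Hom X Y → Hom X Y
    ⊥   : ∀ {X Y} → Hom X Y
    isJSL : ∀ {X Y} → IsIdempotentCommutativeMonoid (_≡_ {A = Hom X Y}) _∨_ ⊥
    ∘-distribʳ-∨ : ∀ {X Y Z} (f g : Hom Y Z) (h : Hom X Y) → (f ∨ g) ∘ h ≡ (f ∘ h) ∨ (g ∘ h)
    ∘-distribˡ-∨ : ∀ {X Y Z} (h : Hom Y Z) (f g : Hom X Y) → h ∘ (f ∨ g) ≡ (h ∘ f) ∨ (h ∘ g)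
    ⊥-∘ : ∀ {X Y Z} (h : Hom X Y) → (⊥ {Y} {Z}) ∘ h ≡ ⊥
    ∘-⊥ : ∀ {X Y Z} (h : Hom Y Z) → h ∘ (⊥ {X} {Y}) ≡ ⊥

  _≤_ : ∀ {X Y} → Hom X Y → Hom X Y → Set ℓ
  f ≤ g = f ∨ g ≡ g

StarOp : ∀ {o ℓ} → Category o ℓ → Set (o ⊔ ℓ)
StarOp C = ∀ {X} → Hom X X → Hom X X
  where open Category C

-- Kleene–Kozen axioms: g∘f* is the least (pre-)fixpoint of x ↦ g ∨ x∘f,
-- and f*∘h is the least (pre-)fixpoint of x ↦ h ∨ f∘x.
-- "least (pre-)fixpoint": it is a fixpoint and lies below every prefixpoint.
record KleeneKozenAxioms {o ℓ} {C : Category o ℓ} (E : JSLEnrichment C)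
                         (_* : StarOp C) : Set (o ⊔ ℓ) where
  open Category C
  open JSLEnrichment E
  field
    right-fix  : ∀ {Y Z} (f : Hom Y Y) (g : Hom Y Z) →
                 g ∨ ((g ∘ (f *)) ∘ f) ≡ g ∘ (f *)
    right-least : ∀ {Y Z} (f : Hom Y Y) (g : Hom Y Z) (x : Hom Y Z) →
                 (g ∨ (x ∘ f)) ≤ x → (g ∘ (f *)) ≤ x
    left-fix   : ∀ {X Y} (f : Hom Y Y) (h : Hom X Y) →
                 h ∨ (f ∘ ((f *) ∘ h)) ≡ (f *) ∘ h
    left-least : ∀ {X Y} (f : Hom Y Y) (h : Hom X Y) (x : Hom X Y) →
                 (h ∨ (f ∘ x)) ≤ x → ((f *) ∘ h) ≤ x

IsKleeneKozen : ∀ {o ℓ} → Category o ℓ → Set (o ⊔ ℓ)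
IsKleeneKozen C = Σ[ E ∈ JSLEnrichment C ] Σ[ s ∈ StarOp C ] KleeneKozenAxioms E s

record StarAxioms {o ℓ} {C : Category o ℓ} (E : JSLEnrichment C)
                  (_* : StarOp C) : Set (o ⊔ ℓ) where
  open Category C
  open JSLEnrichment E
  field
    ax1 : ∀ {X} (f : Hom X X) → f * ≡ id ∨ ((f *) ∘ f)
    ax2 : ∀ {X} → (id {X}) * ≡ id
    ax3 : ∀ {X} (f : Hom X X) → f * ≡ (f ∨ id) *
    ax4 : ∀ {X Y} (h : Hom Y Y) (f : Hom X Y) (g : Hom X X) →
          h ∘ f ≡ f ∘ g → (h *) ∘ f ≡ f ∘ (g *)

HasEnrichmentAndStar : ∀ {o ℓ} → Category o ℓ → Set (o ⊔ ℓ)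
HasEnrichmentAndStar C = Σ[ E ∈ JSLEnrichment C ] Σ[ s ∈ StarOp C ] StarAxioms E s

-- Choosing the identity for g (resp. h) in the least-fixpoint axioms gives the unfolding
-- laws f* = id ∨ f*∘f = id ∨ f∘f*; conditions 2–4 then hold because each side is a
-- fixpoint of the map whose least prefixpoint is the other side. Conversely, the
-- fixpoint equations follow from 1 and from f∘f* = f*∘f (an instance of 4). For
-- leastness, a morphism x with x∘f ≤ x satisfies x∘(f ∨ id) = id∘x, so by 4, 3 and 2
-- x∘f* = id*∘x = x; hence g ≤ x gives g∘f* ≤ x∘f* = x.
module Submission where

open import Defs
open import Level using (Level)
open import Function.Bundles using (_⇔_; mk⇔)
open import Data.Product using (_,_)
open import Relation.Binary.PropositionalEquality
open import Algebra.Structures using (IsIdempotentCommutativeMonoid)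

module _ {o ℓ} {C : Category o ℓ} (E : JSLEnrichment C) where
  open Category C
  open JSLEnrichment E
  module JSL {X Y} = IsIdempotentCommutativeMonoid (isJSL {X} {Y})
  open ≡-Reasoning

  module _ {X Y : Obj} where
    ≤-reflexive : {a b : Hom X Y} → a ≡ b → a ≤ b
    ≤-reflexive {a} refl = JSL.idem a

    ≤-antisym : {a b : Hom X Y} → a ≤ b → b ≤ a → a ≡ b
    ≤-antisym {a} {b} a≤b b≤a = trans (sym b≤a) (trans (JSL.comm b a) a≤b)

    ≤-trans : {a b c : Hom X Y} → a ≤ b → b ≤ c → a ≤ c
    ≤-trans {a} {b} {c} a≤b b≤c = begin
      a ∨ c       ≡⟨ cong (a ∨_) (sym b≤c) ⟩
      a ∨ (b ∨ c) ≡⟨ JSL.assoc a b c ⟨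
      (a ∨ b) ∨ c ≡⟨ cong (_∨ c) a≤b ⟩
      b ∨ c       ≡⟨ b≤c ⟩
      c           ∎

    x∨y≡z⇒x≤z : {a b c : Hom X Y} → a ∨ b ≡ c → a ≤ c
    x∨y≡z⇒x≤z {a} {b} {c} a∨b≡c = begin
      a ∨ c       ≡⟨ cong (a ∨_) (sym a∨b≡c) ⟩
      a ∨ (a ∨ b) ≡⟨ JSL.assoc a a b ⟨
      (a ∨ a) ∨ b ≡⟨ cong (_∨ b) (JSL.idem a) ⟩
      a ∨ b       ≡⟨ a∨b≡c ⟩
      c           ∎

    x∨y≤z⇒x≤z : {a b c : Hom X Y} → (a ∨ b) ≤ c → a ≤ c
    x∨y≤z⇒x≤z = ≤-trans (x∨y≡z⇒x≤z refl)

    x∨y≤z⇒y≤z : {a b c : Hom X Y} → (a ∨ b) ≤ c → b ≤ c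
    x∨y≤z⇒y≤z {a} {b} = ≤-trans (x∨y≡z⇒x≤z (JSL.comm b a))

  ∘-monoˡ-≤ : ∀ {X Y Z} {a b : Hom Y Z} (k : Hom X Y) → a ≤ b → (a ∘ k) ≤ (b ∘ k)
  ∘-monoˡ-≤ {a = a} {b} k a≤b = trans (sym (∘-distribʳ-∨ a b k)) (cong (_∘ k) a≤b)

  ∘-monoʳ-≤ : ∀ {X Y Z} {a b : Hom X Y} (k : Hom Y Z) → a ≤ b → (k ∘ a) ≤ (k ∘ b)
  ∘-monoʳ-≤ {a = a} {b} k a≤b = trans (sym (∘-distribˡ-∨ k a b)) (cong (k ∘_) a≤b)

  ∘-distribˡ-∨-id : ∀ {X Y} (x : Hom X Y) (f : Hom X X) → x ∘ (f ∨ id) ≡ x ∘ f ∨ x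
  ∘-distribˡ-∨-id x f = trans (∘-distribˡ-∨ x f id) (cong (x ∘ f ∨_) (identityʳ x))

  ∘-distribʳ-∨-id : ∀ {X Y} (f : Hom Y Y) (x : Hom X Y) → (f ∨ id) ∘ x ≡ f ∘ x ∨ x
  ∘-distribʳ-∨-id f x = trans (∘-distribʳ-∨ f id x) (cong (f ∘ x ∨_) (identityˡ x))

  module FromKleeneKozen (_* : StarOp C) (K : KleeneKozenAxioms E _*) where
    open KleeneKozenAxioms K

    *-unfoldʳ : ∀ {X} (f : Hom X X) → id ∨ (f *) ∘ f ≡ f *
    *-unfoldʳ f = begin
      id ∨ (f *) ∘ f          ≡⟨ cong (λ z → id ∨ z ∘ f) (identityˡ (f *)) ⟨
      id ∨ (id ∘ (f *)) ∘ f   ≡⟨ right-fix f id ⟩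
      id ∘ (f *)              ≡⟨ identityˡ (f *) ⟩
      f *                     ∎

    *-unfoldˡ : ∀ {X} (f : Hom X X) → id ∨ f ∘ (f *) ≡ f *
    *-unfoldˡ f = begin
      id ∨ f ∘ (f *)          ≡⟨ cong (λ z → id ∨ f ∘ z) (identityʳ (f *)) ⟨
      id ∨ f ∘ ((f *) ∘ id)   ≡⟨ left-fix f id ⟩
      (f *) ∘ id              ≡⟨ identityʳ (f *) ⟩
      f *                     ∎

    *-leastʳ : ∀ {X} (f x : Hom X X) → (id ∨ x ∘ f) ≤ x → (f *) ≤ x
    *-leastʳ f x pre = subst (_≤ x) (identityˡ (f *)) (right-least f id x pre)

    *-id : ∀ {X} → (id {X}) * ≡ id
    *-id = ≤-antisym (*-leastʳ id id (≤-reflexive id∨id∘id≡id)) (x∨y≡z⇒x≤z (*-unfoldʳ id))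
      where
      id∨id∘id≡id : ∀ {X} → id {X} ∨ id ∘ id ≡ id
      id∨id∘id≡id = trans (cong (id ∨_) (identityˡ id)) (JSL.idem id)

    *-∨-id : ∀ {X} (f : Hom X X) → f * ≡ (f ∨ id) *
    *-∨-id f = ≤-antisym (*-leastʳ f ((f ∨ id) *) [f∨id]*-prefixed)
                         (*-leastʳ (f ∨ id) (f *) (≤-reflexive f*-fixed))
      where
      expand : ∀ x → (id ∨ x ∘ f) ∨ x ≡ id ∨ x ∘ (f ∨ id)
      expand x = trans (JSL.assoc id (x ∘ f) x) (cong (id ∨_) (sym (∘-distribˡ-∨-id x f)))

      [f∨id]*-prefixed : (id ∨ ((f ∨ id) *) ∘ f) ≤ ((f ∨ id) *)
      [f∨id]*-prefixed = x∨y≡z⇒x≤z (trans (expand ((f ∨ id) *)) (*-unfoldʳ (f ∨ id)))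

      f*-fixed : id ∨ (f *) ∘ (f ∨ id) ≡ f *
      f*-fixed = begin
        id ∨ (f *) ∘ (f ∨ id)     ≡⟨ expand (f *) ⟨
        (id ∨ (f *) ∘ f) ∨ (f *)  ≡⟨ cong (_∨ (f *)) (*-unfoldʳ f) ⟩
        (f *) ∨ (f *)             ≡⟨ JSL.idem (f *) ⟩
        f *                       ∎

    *-simulation : ∀ {X Y} (h : Hom Y Y) (f : Hom X Y) (g : Hom X X) →
                   h ∘ f ≡ f ∘ g → (h *) ∘ f ≡ f ∘ (g *)
    *-simulation h f g hf≡fg =
      ≤-antisym (left-least h f (f ∘ (g *)) (≤-reflexive f∘g*-fixed))
                (right-least g f ((h *) ∘ f) (≤-reflexive h*∘f-fixed))
      where
      f∘g*-fixed : f ∨ h ∘ (f ∘ (g *)) ≡ f ∘ (g *)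
      f∘g*-fixed = begin
        f ∨ h ∘ (f ∘ (g *))           ≡⟨ cong (f ∨_) (assoc h f (g *)) ⟨
        f ∨ (h ∘ f) ∘ (g *)           ≡⟨ cong (λ z → f ∨ z ∘ (g *)) hf≡fg ⟩
        f ∨ (f ∘ g) ∘ (g *)           ≡⟨ cong₂ _∨_ (sym (identityʳ f)) (assoc f g (g *)) ⟩
        f ∘ id ∨ f ∘ (g ∘ (g *))      ≡⟨ ∘-distribˡ-∨ f id (g ∘ (g *)) ⟨
        f ∘ (id ∨ g ∘ (g *))          ≡⟨ cong (f ∘_) (*-unfoldˡ g) ⟩
        f ∘ (g *)                     ∎

      h*∘f-fixed : f ∨ ((h *) ∘ f) ∘ g ≡ (h *) ∘ f
      h*∘f-fixed = begin
        f ∨ ((h *) ∘ f) ∘ g           ≡⟨ cong (f ∨_) (assoc (h *) f g) ⟩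
        f ∨ (h *) ∘ (f ∘ g)           ≡⟨ cong (λ z → f ∨ (h *) ∘ z) hf≡fg ⟨
        f ∨ (h *) ∘ (h ∘ f)           ≡⟨ cong₂ _∨_ (identityˡ f) (assoc (h *) h f) ⟨
        id ∘ f ∨ ((h *) ∘ h) ∘ f      ≡⟨ ∘-distribʳ-∨ id ((h *) ∘ h) f ⟨
        (id ∨ (h *) ∘ h) ∘ f          ≡⟨ cong (_∘ f) (*-unfoldʳ h) ⟩
        (h *) ∘ f                     ∎

    starAxioms : StarAxioms E _*
    starAxioms = record
      { ax1 = λ f → sym (*-unfoldʳ f)
      ; ax2 = *-id
      ; ax3 = *-∨-id
      ; ax4 = *-simulation
      }

  module FromStarAxioms (_* : StarOp C) (S : StarAxioms E _*) where
    open StarAxioms S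

    *-comm : ∀ {X} (f : Hom X X) → f ∘ (f *) ≡ (f *) ∘ f
    *-comm f = sym (ax4 f f f refl)

    *-absorbʳ : ∀ {X Y} (f : Hom X X) (x : Hom X Y) → (x ∘ f) ≤ x → x ∘ (f *) ≡ x
    *-absorbʳ f x xf≤x = begin
      x ∘ (f *)            ≡⟨ cong (x ∘_) (ax3 f) ⟩
      x ∘ ((f ∨ id) *)     ≡⟨ ax4 id x (f ∨ id) id∘x≡x∘[f∨id] ⟨
      (id *) ∘ x           ≡⟨ cong (_∘ x) ax2 ⟩
      id ∘ x               ≡⟨ identityˡ x ⟩
      x                    ∎
      where
      id∘x≡x∘[f∨id] : id ∘ x ≡ x ∘ (f ∨ id)
      id∘x≡x∘[f∨id] = trans (identityˡ x) (sym (trans (∘-distribˡ-∨-id x f) xf≤x))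

    *-absorbˡ : ∀ {X Y} (f : Hom Y Y) (x : Hom X Y) → (f ∘ x) ≤ x → (f *) ∘ x ≡ x
    *-absorbˡ f x fx≤x = begin
      (f *) ∘ x            ≡⟨ cong (_∘ x) (ax3 f) ⟩
      ((f ∨ id) *) ∘ x     ≡⟨ ax4 (f ∨ id) x id [f∨id]∘x≡x∘id ⟩
      x ∘ (id *)           ≡⟨ cong (x ∘_) ax2 ⟩
      x ∘ id               ≡⟨ identityʳ x ⟩
      x                    ∎
      where
      [f∨id]∘x≡x∘id : (f ∨ id) ∘ x ≡ x ∘ id
      [f∨id]∘x≡x∘id = trans (trans (∘-distribʳ-∨-id f x) fx≤x) (sym (identityʳ x))

    right-fix : ∀ {Y Z} (f : Hom Y Y) (g : Hom Y Z) → g ∨ (g ∘ (f *)) ∘ f ≡ g ∘ (f *)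
    right-fix f g = begin
      g ∨ (g ∘ (f *)) ∘ f       ≡⟨ cong₂ _∨_ (sym (identityʳ g)) (assoc g (f *) f) ⟩
      g ∘ id ∨ g ∘ ((f *) ∘ f)  ≡⟨ ∘-distribˡ-∨ g id ((f *) ∘ f) ⟨
      g ∘ (id ∨ (f *) ∘ f)      ≡⟨ cong (g ∘_) (ax1 f) ⟨
      g ∘ (f *)                 ∎

    left-fix : ∀ {X Y} (f : Hom Y Y) (h : Hom X Y) → h ∨ f ∘ ((f *) ∘ h) ≡ (f *) ∘ h
    left-fix f h = begin
      h ∨ f ∘ ((f *) ∘ h)       ≡⟨ cong₂ _∨_ (identityˡ h) (assoc f (f *) h) ⟨
      id ∘ h ∨ (f ∘ (f *)) ∘ h  ≡⟨ ∘-distribʳ-∨ id (f ∘ (f *)) h ⟨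
      (id ∨ f ∘ (f *)) ∘ h      ≡⟨ cong (λ z → (id ∨ z) ∘ h) (*-comm f) ⟩
      (id ∨ (f *) ∘ f) ∘ h      ≡⟨ cong (_∘ h) (ax1 f) ⟨
      (f *) ∘ h                 ∎

    right-least : ∀ {Y Z} (f : Hom Y Y) (g x : Hom Y Z) →
                  (g ∨ x ∘ f) ≤ x → (g ∘ (f *)) ≤ x
    right-least f g x pre =
      subst ((g ∘ (f *)) ≤_) (*-absorbʳ f x (x∨y≤z⇒y≤z pre)) (∘-monoˡ-≤ (f *) (x∨y≤z⇒x≤z pre))

    left-least : ∀ {X Y} (f : Hom Y Y) (h x : Hom X Y) →
                 (h ∨ f ∘ x) ≤ x → ((f *) ∘ h) ≤ x
    left-least f h x pre =
      subst (((f *) ∘ h) ≤_) (*-absorbˡ f x (x∨y≤z⇒y≤z pre)) (∘-monoʳ-≤ (f *) (x∨y≤z⇒x≤z pre))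

    kleeneKozenAxioms : KleeneKozenAxioms E _*
    kleeneKozenAxioms = record
      { right-fix   = right-fix
      ; right-least = right-least
      ; left-fix    = left-fix
      ; left-least  = left-least
      }

proposition2 : ∀ {o ℓ : Level} (C : Category o ℓ) → IsKleeneKozen C ⇔ HasEnrichmentAndStar C
proposition2 C = mk⇔ (λ { (E , s , K) → E , s , FromKleeneKozen.starAxioms E s K })
                     (λ { (E , s , S) → E , s , FromStarAxioms.kleeneKozenAxioms E s S })
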